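{- Let $n\geq1$, let $\tau$ be a triangular norm without nilpotent elements, and let $\mathbb{X}_1=\langle X_1;\mu_{X_1}\rangle,\dots,\mathbb{X}_n=\langle X_n;\mu_{X_n}\rangle$ be bounded fuzzy lattices. Then $\langle\prod_{i=1}^n X_i;\mu_p\rangle$ is a bounded fuzzy lattice, where $\mu_p((x_1,\dots,x_n),(y_1,\dots,y_n))=\tau^{(n)}(\mu_{X_1}(x_1,y_1),\dots,\mu_{X_n}(x_n,y_n))$.
   Context: A fuzzy relation on a set $X$ is a map $\mu\colon X\times X\to[0,1]$; it is reflexive if $\mu(x,x)=1$; transitive if $\mu(x,y)>0$ and $\mu(y,z)>0$ imply $\mu(x,z)>0$; anti-symmetric if $\mu(x,y)>0$ and $\mu(y,x)>0$ imply $x=y$. A fuzzy poset is $\langle X;\mu\rangle$ with $\mu$ reflexive, transitive, anti-symmetric. For $Y\subseteq X$: $x$ is a fuzzy lower (upper) bound of $Y$ if $\mu(x,y)>0$ (resp. $\mu(y,x)>0$) for all $y\in Y$; a fuzzy lower bound $x_0$ of $Y$ is its fuzzy meet if $\mu(x,x_0)>0$ for every fuzzy lower bound $x$; a fuzzy upper bound $x_0$ is its fuzzy join if $\mu(x_0,x)>0$ for every fuzzy upper bound $x$. A fuzzy lattice is a fuzzy poset in which every two-element subset has a fuzzy meet and a fuzzy join; it is bounded if there exist $0_X,1_X$ with $\mu(0_X,x)>0$ and $\mu(x,1_X)>0$ for all $x$. A triangular norm is a map $\tau\colon[0,1]^2\to[0,1]$ that is associative, commutative, monotone in each argument and satisfies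 $\tau(a,1)=a$. Its $n$-ary extension: $\tau^{(1)}(a_1)=a_1$, $\tau^{(n)}(a_1,\dots,a_n)=\tau(\tau^{(n-1)}(a_1,\dots,a_{n-1}),a_n)$. An element $a\in(0,1)$ is a nilpotent element of $\tau$ if $\tau^{(m)}(a,\dots,a)=0$ for some positive integer $m$. -}

module Defs where

open import Level using (0ℓ)
open import Data.Nat using (ℕ; zero; suc)
open import Data.Fin using (Fin; zero; suc; inject₁; fromℕ)
open import Data.Product using (_×_; _,_; ∃; ∃-syntax; Σ)
open import Data.Unit using (⊤)
open import Function using (_∘_)
open import Relation.Binary.Core using (Rel)
open import Relation.Binary.Structures using (IsTotalOrder)
open import Relation.Binary.PropositionalEquality using (_≡_; _≢_)
open import Relation.Nullary using (¬_)

-- An abstract "unit interval": a bounded total order with 𝟎 ≠ 𝟏.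
-- The real interval [0,1] (with its usual order) is an instance.
record UnitInterval : Set₁ where
  field
    I            : Set
    _≤_          : Rel I 0ℓ
    isTotalOrder : IsTotalOrder _≡_ _≤_
    𝟎 𝟏          : I
    𝟎≢𝟏          : 𝟎 ≢ 𝟏
    𝟎-min        : ∀ a → 𝟎 ≤ a
    𝟏-max        : ∀ a → a ≤ 𝟏

  _<_ : I → I → Set
  a < b = (a ≤ b) × (a ≢ b)

module _ (U : UnitInterval) where
  open UnitInterval U

  record TNorm : Set where
    field
      τ      : I → I → I
      assoc  : ∀ a b c → τ (τ a b) c ≡ τ a (τ b c)
      comm   : ∀ a b → τ a b ≡ τ b a
      mono   : ∀ {a a′ b b′} → a ≤ a′ → b ≤ b′ → τ a b ≤ τ a′ b′
      unit   : ∀ a → τ a 𝟏 ≡ a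

    -- n-ary extension, with n = suc k:
    -- τ^(1)(a₁) = a₁,  τ^(n)(a₁..aₙ) = τ(τ^(n-1)(a₁..aₙ₋₁), aₙ)
    τⁿ : (k : ℕ) → (Fin (suc k) → I) → I
    τⁿ zero    f = f zero
    τⁿ (suc k) f = τ (τⁿ k (f ∘ inject₁)) (f (fromℕ (suc k)))

    -- a ∈ (0,1) is nilpotent if τ^(m)(a,…,a) = 0 for some m ≥ 1 (m = suc k)
    Nilpotent : I → Set
    Nilpotent a = (𝟎 < a) × (a < 𝟏) × ∃[ k ] τⁿ k (λ _ → a) ≡ 𝟎

    NoNilpotent : Set
    NoNilpotent = ∀ a → ¬ Nilpotent a

  Pos : I → Set
  Pos a = 𝟎 < a

  FuzzyRel : Set → Set
  FuzzyRel X = X → X → I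

  module _ {X : Set} (μ : FuzzyRel X) where
    Reflexive : Set
    Reflexive = ∀ x → μ x x ≡ 𝟏

    Transitive : Set
    Transitive = ∀ x y z → Pos (μ x y) → Pos (μ y z) → Pos (μ x z)

    AntiSymmetric : Set
    AntiSymmetric = ∀ x y → Pos (μ x y) → Pos (μ y x) → x ≡ y

    IsFuzzyPoset : Set
    IsFuzzyPoset = Reflexive × Transitive × AntiSymmetric

    LowerBound : X → X → X → Set
    LowerBound x y z = Pos (μ z x) × Pos (μ z y)

    UpperBound : X → X → X → Set
    UpperBound x y z = Pos (μ x z) × Pos (μ y z)

    IsMeet : X → X → X → Set
    IsMeet x y m = LowerBound x y m × (∀ z → LowerBound x y z → Pos (μ z m))

    IsJoin : X → X → X → Set
    IsJoin x y j = UpperBound x y j × (∀ z → UpperBound x y z → Pos (μ j z))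

    IsFuzzyLattice : Set
    IsFuzzyLattice = IsFuzzyPoset
                   × (∀ x y → ∃[ m ] IsMeet x y m)
                   × (∀ x y → ∃[ j ] IsJoin x y j)

    IsBounded : Set
    IsBounded = ∃[ b ] ∃[ t ] ((∀ x → Pos (μ b x)) × (∀ x → Pos (μ x t)))

    IsBoundedFuzzyLattice : Set
    IsBoundedFuzzyLattice = IsFuzzyLattice × IsBounded

Prod : (n : ℕ) → (Fin n → Set) → Set
Prod zero    X = ⊤
Prod (suc n) X = X zero × Prod n (X ∘ suc)

proj : ∀ {n} {X : Fin n → Set} → Prod n X → (i : Fin n) → X i
proj (x , _)  zero    = x
proj (_ , xs) (suc i) = proj xs i

μp : (U : UnitInterval) (T : TNorm U) (k : ℕ) (X : Fin (suc k) → Set)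
   → ((i : Fin (suc k)) → FuzzyRel U (X i))
   → FuzzyRel U (Prod (suc k) X)
μp U T k X μ x y = TNorm.τⁿ T k (λ i → μ i (proj {X = X} x i) (proj {X = X} y i))

-- A t-norm without nilpotent elements never sends two positive degrees to 0:
-- if a ≤ b are positive then τ(a,b) ≥ τ(a,a) = τ^(2)(a,a) > 0.  Since moreover
-- τ(a,b) ≤ a, b, the product degree μ_p(x,y) is positive exactly when every
-- μ_{X_i}(x_i,y_i) is.  Each axiom of a bounded fuzzy lattice speaks only about
-- positivity of degrees (and, for reflexivity, about the value 1, which τ^(n)
-- preserves), so all of them transfer componentwise, meets, joins and bounds
-- being formed coordinate by coordinate.
module Submission where

open import Defs
open import Data.Nat using (ℕ; zero; suc)
open import Data.Fin using (Fin; zero; suc; inject₁; fromℕ)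
open import Data.Fin.Relation.Unary.Top using (view; ‵fromℕ; ‵inject₁)
open import Data.Product using (_×_; _,_; ∃-syntax; Σ; proj₁; proj₂)
open import Data.Sum using (inj₁; inj₂)
open import Data.Unit using (tt)
open import Function using (_∘_)
open import Relation.Binary.PropositionalEquality
  using (_≡_; refl; sym; trans; cong₂; subst)
open import Relation.Binary.Structures using (IsTotalOrder)

Prod-ext : ∀ {n} {X : Fin n → Set} (x y : Prod n X)
         → (∀ i → proj {X = X} x i ≡ proj {X = X} y i) → x ≡ y
Prod-ext {zero}  _        _        _  = refl
Prod-ext {suc n} (x , xs) (y , ys) eq = cong₂ _,_ (eq zero) (Prod-ext xs ys (eq ∘ suc))

Prod-choice : ∀ {n} {X : Fin n → Set} {P : (i : Fin n) → X i → Set}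
            → (∀ i → Σ (X i) (P i)) → Σ (Prod n X) λ x → ∀ i → P i (proj {X = X} x i)
Prod-choice {zero}  _ = tt , λ ()
Prod-choice {suc n} h with Prod-choice (h ∘ suc)
... | xs , hs = (proj₁ (h zero) , xs) , λ { zero → proj₂ (h zero) ; (suc i) → hs i }

module _ (U : UnitInterval) where
  open UnitInterval U
  open IsTotalOrder isTotalOrder using (total; antisym; reflexive)
    renaming (trans to ≤-trans)

  ≤-refl : ∀ {a} → a ≤ a
  ≤-refl = reflexive refl

  Pos-mono : ∀ {a b} → Pos U a → a ≤ b → Pos U b
  Pos-mono {a} {b} (_ , 𝟎≢a) a≤b = 𝟎-min b , λ 𝟎≡b →
    𝟎≢a (antisym (𝟎-min a) (subst (a ≤_) (sym 𝟎≡b) a≤b))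

  module _ (T : TNorm U) where
    open TNorm T

    τ-≤ˡ : ∀ a b → τ a b ≤ a
    τ-≤ˡ a b = subst (τ a b ≤_) (unit a) (mono ≤-refl (𝟏-max b))

    τ-≤ʳ : ∀ a b → τ a b ≤ b
    τ-≤ʳ a b = subst (_≤ b) (comm b a) (τ-≤ˡ b a)

    τⁿ-≤ : ∀ k f i → τⁿ k f ≤ f i
    τⁿ-≤ zero    f zero = ≤-refl
    τⁿ-≤ (suc k) f i with view i
    ... | ‵fromℕ     = τ-≤ʳ _ _
    ... | ‵inject₁ j = ≤-trans (τ-≤ˡ _ _) (τⁿ-≤ k (f ∘ inject₁) j)

    τⁿ-𝟏 : ∀ k f → (∀ i → f i ≡ 𝟏) → τⁿ k f ≡ 𝟏
    τⁿ-𝟏 zero    f h = h zero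
    τⁿ-𝟏 (suc k) f h =
      trans (cong₂ τ (τⁿ-𝟏 k (f ∘ inject₁) (h ∘ inject₁)) (h (fromℕ (suc k)))) (unit 𝟏)

    PreservesPositivity : Set
    PreservesPositivity = ∀ {a b} → Pos U a → Pos U b → Pos U (τ a b)

    -- τ a a is τⁿ 1 (λ _ → a), so if it vanished a would be nilpotent.
    noNilpotent⇒τ-square-pos : NoNilpotent → ∀ {a} → Pos U a → Pos U (τ a a)
    noNilpotent⇒τ-square-pos noNil {a} 0<a = 𝟎-min _ , λ 𝟎≡τaa →
      noNil a (0<a , (𝟏-max a , λ a≡𝟏 → 𝟎≢𝟏 (trans 𝟎≡τaa (a≡𝟏⇒τaa≡𝟏 a≡𝟏))) , 1 , sym 𝟎≡τaa)
      where
      a≡𝟏⇒τaa≡𝟏 : a ≡ 𝟏 → τ a a ≡ 𝟏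
      a≡𝟏⇒τaa≡𝟏 refl = unit 𝟏

    noNilpotent⇒preservesPositivity : NoNilpotent → PreservesPositivity
    noNilpotent⇒preservesPositivity noNil {a} {b} 0<a 0<b with total a b
    ... | inj₁ a≤b = Pos-mono (noNilpotent⇒τ-square-pos noNil 0<a) (mono ≤-refl a≤b)
    ... | inj₂ b≤a = Pos-mono (noNilpotent⇒τ-square-pos noNil 0<b) (mono b≤a ≤-refl)

    τⁿ-pos⁻ : ∀ k f → Pos U (τⁿ k f) → ∀ i → Pos U (f i)
    τⁿ-pos⁻ k f p i = Pos-mono p (τⁿ-≤ k f i)

    τⁿ-pos : PreservesPositivity → ∀ k f → (∀ i → Pos U (f i)) → Pos U (τⁿ k f)
    τⁿ-pos pp zero    f h = h zero
    τⁿ-pos pp (suc k) f h = pp (τⁿ-pos pp k (f ∘ inject₁) (h ∘ inject₁)) (h (fromℕ (suc k)))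

    module Product (pp : PreservesPositivity) (k : ℕ) (X : Fin (suc k) → Set)
             (μ : (i : Fin (suc k)) → FuzzyRel U (X i)) where
      private
        μₚ = μp U T k X μ
        _!_ = proj {X = X}

      μp-pos : ∀ x y → (∀ i → Pos U (μ i (x ! i) (y ! i))) → Pos U (μₚ x y)
      μp-pos x y = τⁿ-pos pp k _

      μp-pos⁻ : ∀ x y → Pos U (μₚ x y) → ∀ i → Pos U (μ i (x ! i) (y ! i))
      μp-pos⁻ x y = τⁿ-pos⁻ k _

      μp-reflexive : (∀ i → Reflexive U (μ i)) → Reflexive U μₚ
      μp-reflexive refl′ x = τⁿ-𝟏 k _ λ i → refl′ i (x ! i)

      μp-transitive : (∀ i → Transitive U (μ i)) → Transitive U μₚ
      μp-transitive trans′ x y z xy yz = μp-pos x z λ i →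
        trans′ i _ _ _ (μp-pos⁻ x y xy i) (μp-pos⁻ y z yz i)

      μp-antiSymmetric : (∀ i → AntiSymmetric U (μ i)) → AntiSymmetric U μₚ
      μp-antiSymmetric antisym′ x y xy yx = Prod-ext x y λ i →
        antisym′ i _ _ (μp-pos⁻ x y xy i) (μp-pos⁻ y x yx i)

      μp-isMeet : ∀ x y m → (∀ i → IsMeet U (μ i) (x ! i) (y ! i) (m ! i)) → IsMeet U μₚ x y m
      μp-isMeet x y m h =
          (μp-pos m x (proj₁ ∘ proj₁ ∘ h) , μp-pos m y (proj₂ ∘ proj₁ ∘ h))
        , λ z (zx , zy) → μp-pos z m λ i → proj₂ (h i) _ (μp-pos⁻ z x zx i , μp-pos⁻ z y zy i)

      μp-isJoin : ∀ x y j → (∀ i → IsJoin U (μ i) (x ! i) (y ! i) (j ! i)) → IsJoin U μₚ x y j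
      μp-isJoin x y j h =
          (μp-pos x j (proj₁ ∘ proj₁ ∘ h) , μp-pos y j (proj₂ ∘ proj₁ ∘ h))
        , λ z (xz , yz) → μp-pos j z λ i → proj₂ (h i) _ (μp-pos⁻ x z xz i , μp-pos⁻ y z yz i)

      μp-meets : (∀ i x y → ∃[ m ] IsMeet U (μ i) x y m) → ∀ x y → ∃[ m ] IsMeet U μₚ x y m
      μp-meets meet x y with Prod-choice (λ i → meet i (x ! i) (y ! i))
      ... | m , hm = m , μp-isMeet x y m hm

      μp-joins : (∀ i x y → ∃[ j ] IsJoin U (μ i) x y j) → ∀ x y → ∃[ j ] IsJoin U μₚ x y j
      μp-joins join x y with Prod-choice (λ i → join i (x ! i) (y ! i))
      ... | j , hj = j , μp-isJoin x y j hj

      μp-isBounded : (∀ i → IsBounded U (μ i)) → IsBounded U μₚ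
      μp-isBounded bnd =
        b , t , (λ x → μp-pos b x λ i → hb i (x ! i)) , (λ x → μp-pos x t λ i → ht i (x ! i))
        where
        bottoms : ∀ i → Σ (X i) λ b → ∀ a → Pos U (μ i b a)
        bottoms i = let (b , _ , hb , _) = bnd i in b , hb
        tops : ∀ i → Σ (X i) λ t → ∀ a → Pos U (μ i a t)
        tops i = let (_ , t , _ , ht) = bnd i in t , ht
        b = proj₁ (Prod-choice bottoms)
        hb = proj₂ (Prod-choice bottoms)
        t = proj₁ (Prod-choice tops)
        ht = proj₂ (Prod-choice tops)

corollary4p10 : (U : UnitInterval) (T : TNorm U) → TNorm.NoNilpotent T
    → (k : ℕ) (X : Fin (suc k) → Set) (μ : (i : Fin (suc k)) → FuzzyRel U (X i))
    → ((i : Fin (suc k)) → IsBoundedFuzzyLattice U (μ i))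
    → IsBoundedFuzzyLattice U (μp U T k X μ)
corollary4p10 U T noNil k X μ L =
  ( ( μp-reflexive (proj₁ ∘ poset)
    , μp-transitive (proj₁ ∘ proj₂ ∘ poset)
    , μp-antiSymmetric (proj₂ ∘ proj₂ ∘ poset) )
  , μp-meets (proj₁ ∘ proj₂ ∘ lattice)
  , μp-joins (proj₂ ∘ proj₂ ∘ lattice) )
  , μp-isBounded (proj₂ ∘ L)
  where
  open Product U T (noNilpotent⇒preservesPositivity U T noNil) k X μ
  lattice = proj₁ ∘ L
  poset = proj₁ ∘ lattice
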